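{- Let $m,n,W$ be positive integers with $W\mid m$, and let $\lambda$ be a positive integer with $\lambda\mid W$. Let $r\in[n]$ and let $U\subseteq[m]^n$ be a set that does not depend on coordinate $r$. Then $$\left|\left\{x\in U:\ (\mathrm{wt}(x)\bmod W)\in[0,W/\lambda)\right\}\right|=\frac{1}{\lambda}|U|.$$
   Context: $[a]=\{0,1,\dots,a-1\}$. For $x\in[m]^n$, $\mathrm{wt}(x)=\sum_{j\in[n]}x_j$. A set $U\subseteq[m]^n$ does not depend on coordinate $r$ if for every $x\in U$ and every $y\in[m]$, the vector obtained from $x$ by replacing its $r$-th coordinate with $y$ also lies in $U$. -}

module Defs where

open import Data.Nat using (ℕ; zero; suc; _+_; _<ᵇ_)
open import Data.Nat.DivMod using (_%_; _/_)
open import Data.Nat using (NonZero)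
open import Data.Fin using (Fin; toℕ)
open import Data.Vec using (Vec; []; _∷_; _[_]≔_)
open import Data.List using (List; [_]; map; concatMap; allFin; length; filterᵇ)
open import Data.Bool using (Bool; true; _∧_)
open import Relation.Binary.PropositionalEquality using (_≡_)

allVecs : (m n : ℕ) → List (Vec (Fin m) n)
allVecs m zero = [ [] ]
allVecs m (suc n) = concatMap (λ i → map (i ∷_) (allVecs m n)) (allFin m)

Subset : (m n : ℕ) → Set
Subset m n = Vec (Fin m) n → Bool

card : ∀ {m n} → Subset m n → ℕ
card {m} {n} U = length (filterᵇ U (allVecs m n))

wt : ∀ {m n} → Vec (Fin m) n → ℕ
wt [] = 0
wt (x ∷ xs) = toℕ x + wt xs

IndepOf : ∀ {m n} → Subset m n → Fin n → Set
IndepOf {m} {n} U r =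
  ∀ (x : Vec (Fin m) n) (y : Fin m) → U x ≡ true → U (x [ r ]≔ y) ≡ true

lowPart : ∀ {m n} (U : Subset m n) (W l : ℕ) .{{_ : NonZero W}} .{{_ : NonZero l}} → Subset m n
lowPart U W l x = U x ∧ ((wt x % W) <ᵇ (W / l))

-- Fix every coordinate of x except the r-th. Since U does not depend on coordinate r, the m
-- completions either all lie in U or none does, and their weights are m consecutive integers.
-- As W ∣ m, such a window meets every residue class mod W exactly m / W times, so exactly
-- (m / W) · (W / λ) = m / λ of the completions have weight residue in [0, W / λ).
-- Summing over the remaining coordinates gives the claim.
module Submission where

open import Defs
open import Data.Nat using (ℕ; _*_; NonZero)
open import Data.Nat.Divisibility using (_∣_)
open import Data.Fin using (Fin)
open import Relation.Binary.PropositionalEquality using (_≡_)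

open import Data.Bool using (Bool; true; false; _∧_)
open import Data.Bool.Properties using (⇔→≡)
open import Data.Fin using (zero; suc; toℕ)
open import Data.Vec using (Vec; _∷_)
open import Data.List using (List; []; _∷_; _++_; map; concatMap; allFin; length; filterᵇ; tabulate)
open import Data.List.Properties using (map-++; map-cong; map-∘; map-tabulate; length-tabulate)
open import Data.Nat using (zero; suc; _+_; _<_; _<ᵇ_; _⊓_; z<s; s<s)
open import Data.Nat.DivMod using (_%_; _/_; [m+n]%n≡m%n; m<n⇒m%n≡m; m/n≤m; m*[n/m]≡n)
open import Data.Nat.Divisibility using (divides)
open import Data.Nat.ListAction using (sum)
open import Data.Nat.ListAction.Properties using (sum-++)
open import Data.Nat.Properties
open import Algebra.Properties.CommutativeSemigroup +-commutativeSemigroup using (interchange)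
open import Algebra.Properties.CommutativeSemigroup *-commutativeSemigroup using (x∙yz≈y∙xz)
open import Function using (id; _∘_; mk⇔)
open import Relation.Binary.PropositionalEquality using (refl; sym; trans; cong; cong₂; module ≡-Reasoning)

open ≡-Reasoning

𝟙 : Bool → ℕ
𝟙 true  = 1
𝟙 false = 0

∑ : {A : Set} → List A → (A → ℕ) → ℕ
∑ xs f = sum (map f xs)

∑< : ℕ → (ℕ → ℕ) → ℕ
∑< zero    f = 0
∑< (suc n) f = f 0 + ∑< n (f ∘ suc)

module _ {A : Set} where

  ∑-cong : (xs : List A) {f g : A → ℕ} → (∀ x → f x ≡ g x) → ∑ xs f ≡ ∑ xs g
  ∑-cong xs f≗g = cong sum (map-cong f≗g xs)

  ∑-++ : (xs ys : List A) (f : A → ℕ) → ∑ (xs ++ ys) f ≡ ∑ xs f + ∑ ys f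
  ∑-++ xs ys f = trans (cong sum (map-++ f xs ys)) (sum-++ (map f xs) (map f ys))

  ∑-map : {B : Set} (g : B → A) (xs : List B) (f : A → ℕ) → ∑ (map g xs) f ≡ ∑ xs (f ∘ g)
  ∑-map g xs f = cong sum (sym (map-∘ xs))

  ∑-concatMap : {B : Set} (h : B → List A) (xs : List B) (f : A → ℕ) →
                ∑ (concatMap h xs) f ≡ ∑ xs (λ x → ∑ (h x) f)
  ∑-concatMap h []       f = refl
  ∑-concatMap h (x ∷ xs) f =
    trans (∑-++ (h x) (concatMap h xs) f) (cong (∑ (h x) f +_) (∑-concatMap h xs f))

  ∑-const : (xs : List A) (k : ℕ) → ∑ xs (λ _ → k) ≡ length xs * k
  ∑-const []       k = refl
  ∑-const (x ∷ xs) k = cong (k +_) (∑-const xs k)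

  ∑-+ : (xs : List A) (f g : A → ℕ) → ∑ xs (λ x → f x + g x) ≡ ∑ xs f + ∑ xs g
  ∑-+ []       f g = refl
  ∑-+ (x ∷ xs) f g = trans (cong (f x + g x +_) (∑-+ xs f g)) (interchange (f x) (g x) _ _)

  ∑-*ˡ : (xs : List A) (k : ℕ) (f : A → ℕ) → ∑ xs (λ x → k * f x) ≡ k * ∑ xs f
  ∑-*ˡ []       k f = sym (*-zeroʳ k)
  ∑-*ˡ (x ∷ xs) k f = trans (cong (k * f x +_) (∑-*ˡ xs k f)) (sym (*-distribˡ-+ k (f x) _))

  length-filterᵇ : (p : A → Bool) (xs : List A) → length (filterᵇ p xs) ≡ ∑ xs (𝟙 ∘ p)
  length-filterᵇ p []       = refl
  length-filterᵇ p (x ∷ xs) with p x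
  ... | true  = cong suc (length-filterᵇ p xs)
  ... | false = length-filterᵇ p xs

∑-swap : {A B : Set} (xs : List A) (ys : List B) (f : A → B → ℕ) →
         ∑ xs (λ x → ∑ ys (f x)) ≡ ∑ ys (λ y → ∑ xs (λ x → f x y))
∑-swap []       ys f = sym (trans (∑-const ys 0) (*-zeroʳ (length ys)))
∑-swap (x ∷ xs) ys f =
  trans (cong (∑ ys (f x) +_) (∑-swap xs ys f)) (sym (∑-+ ys (f x) (λ y → ∑ xs (λ x′ → f x′ y))))

∑-allFin : ∀ n (h : ℕ → ℕ) → ∑ (allFin n) (h ∘ toℕ) ≡ ∑< n h
∑-allFin zero    h = refl
∑-allFin (suc n) h = cong (h 0 +_) (begin
  sum (map (h ∘ toℕ) (tabulate {n = n} suc))  ≡⟨ cong sum (map-tabulate {n = n} suc (h ∘ toℕ)) ⟩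
  sum (tabulate {n = n} (h ∘ suc ∘ toℕ))      ≡⟨ cong sum (map-tabulate {n = n} id (h ∘ suc ∘ toℕ)) ⟨
  ∑ (allFin n) (h ∘ suc ∘ toℕ)                ≡⟨ ∑-allFin n (h ∘ suc) ⟩
  ∑< n (h ∘ suc)                              ∎)

∑<-cong : ∀ n {f g : ℕ → ℕ} → (∀ i → f i ≡ g i) → ∑< n f ≡ ∑< n g
∑<-cong zero    f≗g = refl
∑<-cong (suc n) f≗g = cong₂ _+_ (f≗g 0) (∑<-cong n (f≗g ∘ suc))

∑<-cong< : ∀ n {f g : ℕ → ℕ} → (∀ i → i < n → f i ≡ g i) → ∑< n f ≡ ∑< n g
∑<-cong< zero    f≗g = refl
∑<-cong< (suc n) f≗g = cong₂ _+_ (f≗g 0 z<s) (∑<-cong< n (λ i i<n → f≗g (suc i) (s<s i<n)))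

∑<-+ : ∀ a b (f : ℕ → ℕ) → ∑< (a + b) f ≡ ∑< a f + ∑< b (λ i → f (a + i))
∑<-+ zero    b f = refl
∑<-+ (suc a) b f = trans (cong (f 0 +_) (∑<-+ a b (f ∘ suc))) (sym (+-assoc (f 0) _ _))

∑<-below : ∀ n t → ∑< n (λ i → 𝟙 (i <ᵇ t)) ≡ n ⊓ t
∑<-below zero    t       = refl
∑<-below (suc n) zero    = trans (∑<-below n zero) (⊓-zeroʳ n)
∑<-below (suc n) (suc t) = cong suc (∑<-below n t)

module _ (p : ℕ) (f : ℕ → ℕ) (periodic : ∀ d → f (d + p) ≡ f d) where

  ∑<-window-shift : ∀ d → ∑< p (λ i → f (suc d + i)) ≡ ∑< p (λ i → f (d + i))
  ∑<-window-shift d = +-cancelˡ-≡ (f d) _ _ (begin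
    f d + ∑< p (λ i → f (suc d + i))
      ≡⟨ cong₂ _+_ (cong f (sym (+-identityʳ d))) (∑<-cong p (cong f ∘ sym ∘ +-suc d)) ⟩
    ∑< (1 + p) g                      ≡⟨ cong (λ k → ∑< k g) (+-comm 1 p) ⟩
    ∑< (p + 1) g                      ≡⟨ ∑<-+ p 1 g ⟩
    ∑< p g + (g (p + 0) + 0)          ≡⟨ cong (∑< p g +_) (trans (+-identityʳ _) (cong g (+-identityʳ p))) ⟩
    ∑< p g + f (d + p)                ≡⟨ cong (∑< p g +_) (periodic d) ⟩
    ∑< p g + f d                      ≡⟨ +-comm _ (f d) ⟩
    f d + ∑< p g                      ∎)
    where
    g : ℕ → ℕ
    g i = f (d + i)

  ∑<-window : ∀ d → ∑< p (λ i → f (d + i)) ≡ ∑< p f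
  ∑<-window zero    = refl
  ∑<-window (suc d) = trans (∑<-window-shift d) (∑<-window d)

  ∑<-periods : ∀ k d → ∑< (k * p) (λ i → f (d + i)) ≡ k * ∑< p f
  ∑<-periods zero    d = refl
  ∑<-periods (suc k) d = begin
    ∑< (p + k * p) (λ i → f (d + i))                              ≡⟨ ∑<-+ p (k * p) _ ⟩
    ∑< p (λ i → f (d + i)) + ∑< (k * p) (λ i → f (d + (p + i)))
      ≡⟨ cong (_ +_) (∑<-cong (k * p) (cong f ∘ sym ∘ +-assoc d p)) ⟩
    ∑< p (λ i → f (d + i)) + ∑< (k * p) (λ i → f (d + p + i))    ≡⟨ cong₂ _+_ (∑<-window d) (∑<-periods k (d + p)) ⟩
    ∑< p f + k * ∑< p f                                           ∎

Balanced : (m l : ℕ) → (ℕ → Bool) → Set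
Balanced m l P = ∀ d → l * ∑< m (λ i → 𝟙 (P (d + i))) ≡ m

lowResidue : (W l : ℕ) .{{_ : NonZero W}} .{{_ : NonZero l}} → ℕ → Bool
lowResidue W l k = k % W <ᵇ W / l

lowResidue-balanced : ∀ {m W l} .{{_ : NonZero W}} .{{_ : NonZero l}} →
                      W ∣ m → l ∣ W → Balanced m l (lowResidue W l)
lowResidue-balanced {W = W} {l} (divides k refl) l∣W d = begin
  l * ∑< (k * W) (λ i → χ (d + i))  ≡⟨ cong (l *_) (∑<-periods W χ periodic k d) ⟩
  l * (k * ∑< W χ)                  ≡⟨ cong (λ s → l * (k * s)) one-period ⟩
  l * (k * (W / l))                 ≡⟨ x∙yz≈y∙xz l k (W / l) ⟩
  k * (l * (W / l))                 ≡⟨ cong (k *_) (m*[n/m]≡n l∣W) ⟩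
  k * W                             ∎
  where
  χ : ℕ → ℕ
  χ = 𝟙 ∘ lowResidue W l

  periodic : ∀ d → χ (d + W) ≡ χ d
  periodic d = cong (λ r → 𝟙 (r <ᵇ W / l)) ([m+n]%n≡m%n d W)

  one-period : ∑< W χ ≡ W / l
  one-period = begin
    ∑< W χ                          ≡⟨ ∑<-cong< W (λ i i<W → cong (λ r → 𝟙 (r <ᵇ W / l)) (m<n⇒m%n≡m i<W)) ⟩
    ∑< W (λ i → 𝟙 (i <ᵇ W / l))     ≡⟨ ∑<-below W (W / l) ⟩
    W ⊓ (W / l)                     ≡⟨ m≥n⇒m⊓n≡n (m/n≤m W l) ⟩
    W / l                           ∎

∑-allVecs-suc : ∀ m n (f : Vec (Fin m) (suc n) → ℕ) →
                ∑ (allVecs m (suc n)) f ≡ ∑ (allFin m) (λ i → ∑ (allVecs m n) (λ xs → f (i ∷ xs)))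
∑-allVecs-suc m n f = trans (∑-concatMap (λ i → map (i ∷_) (allVecs m n)) (allFin m) f)
                            (∑-cong (allFin m) (λ i → ∑-map (i ∷_) (allVecs m n) f))

-- A constant f is either everywhere false, making both sides vanish, or everywhere true, making the
-- claim the density hypothesis on g.
∑-∧-constant : {A : Set} (l : ℕ) (xs : List A) (f g : A → Bool) → (∀ x y → f x ≡ f y) →
               l * ∑ xs (𝟙 ∘ g) ≡ length xs → l * ∑ xs (λ x → 𝟙 (f x ∧ g x)) ≡ ∑ xs (𝟙 ∘ f)
∑-∧-constant l []       f g constant density = *-zeroʳ l
∑-∧-constant l (x ∷ xs) f g constant density
  rewrite ∑-cong (x ∷ xs) (λ y → cong (λ b → 𝟙 (b ∧ g y)) (constant y x))
        | ∑-cong (x ∷ xs) (λ y → cong 𝟙 (constant y x))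
  with f x
... | true  = trans density (sym (trans (∑-const (x ∷ xs) 1) (*-identityʳ _)))
... | false = trans (cong (l *_) zeros) (trans (*-zeroʳ l) (sym zeros))
  where
  zeros : ∑ (x ∷ xs) (λ _ → 0) ≡ 0
  zeros = trans (∑-const (x ∷ xs) 0) (*-zeroʳ (length (x ∷ xs)))

module _ {m l : ℕ} {P : ℕ → Bool} (balanced : Balanced m l P) where

  balanced-allFin : ∀ d → l * ∑ (allFin m) (λ i → 𝟙 (P (d + toℕ i))) ≡ length (allFin m)
  balanced-allFin d = begin
    l * ∑ (allFin m) (λ i → 𝟙 (P (d + toℕ i)))  ≡⟨ cong (l *_) (∑-allFin m (λ i → 𝟙 (P (d + i)))) ⟩
    l * ∑< m (λ i → 𝟙 (P (d + i)))              ≡⟨ balanced d ⟩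
    m                                           ≡⟨ length-tabulate id ⟨
    length (allFin m)                           ∎

  -- The offset c is the weight of the coordinates already fixed in front of coordinate r.
  balanced-count : ∀ n (U : Subset m n) (r : Fin n) → IndepOf U r → ∀ c →
                   l * ∑ (allVecs m n) (λ x → 𝟙 (U x ∧ P (c + wt x))) ≡ ∑ (allVecs m n) (𝟙 ∘ U)
  balanced-count (suc n) U zero indep c = begin
    l * ∑ (allVecs m (suc n)) F                          ≡⟨ cong (l *_) (∑-allVecs-suc m n F) ⟩
    l * ∑ (allFin m) (λ i → ∑ vs (λ xs → F (i ∷ xs)))    ≡⟨ cong (l *_) (∑-swap (allFin m) vs _) ⟩
    l * ∑ vs (λ xs → ∑ (allFin m) (λ i → F (i ∷ xs)))    ≡⟨ ∑-*ˡ vs l _ ⟨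
    ∑ vs (λ xs → l * ∑ (allFin m) (λ i → F (i ∷ xs)))    ≡⟨ ∑-cong vs column ⟩
    ∑ vs (λ xs → ∑ (allFin m) (λ i → 𝟙 (U (i ∷ xs))))    ≡⟨ ∑-swap vs (allFin m) _ ⟩
    ∑ (allFin m) (λ i → ∑ vs (λ xs → 𝟙 (U (i ∷ xs))))    ≡⟨ ∑-allVecs-suc m n (𝟙 ∘ U) ⟨
    ∑ (allVecs m (suc n)) (𝟙 ∘ U)                        ∎
    where
    vs : List (Vec (Fin m) n)
    vs = allVecs m n
    F : Vec (Fin m) (suc n) → ℕ
    F x = 𝟙 (U x ∧ P (c + wt x))
    column : ∀ xs → l * ∑ (allFin m) (λ i → F (i ∷ xs)) ≡ ∑ (allFin m) (λ i → 𝟙 (U (i ∷ xs)))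
    column xs = ∑-∧-constant l (allFin m) (λ i → U (i ∷ xs)) (λ i → P (c + (toℕ i + wt xs)))
      (λ i j → ⇔→≡ (mk⇔ (indep (i ∷ xs) j) (indep (j ∷ xs) i)))
      (trans (cong (l *_) (∑-cong (allFin m) (λ i → cong (𝟙 ∘ P) (shift i))))
             (balanced-allFin (c + wt xs)))
      where
      shift : ∀ i → c + (toℕ i + wt xs) ≡ c + wt xs + toℕ i
      shift i = trans (cong (c +_) (+-comm (toℕ i) (wt xs))) (sym (+-assoc c (wt xs) (toℕ i)))
  balanced-count (suc n) U (suc r) indep c = begin
    l * ∑ (allVecs m (suc n)) F                          ≡⟨ cong (l *_) (∑-allVecs-suc m n F) ⟩
    l * ∑ (allFin m) (λ i → ∑ vs (λ xs → F (i ∷ xs)))    ≡⟨ ∑-*ˡ (allFin m) l _ ⟨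
    ∑ (allFin m) (λ i → l * ∑ vs (λ xs → F (i ∷ xs)))    ≡⟨ ∑-cong (allFin m) row ⟩
    ∑ (allFin m) (λ i → ∑ vs (λ xs → 𝟙 (U (i ∷ xs))))    ≡⟨ ∑-allVecs-suc m n (𝟙 ∘ U) ⟨
    ∑ (allVecs m (suc n)) (𝟙 ∘ U)                        ∎
    where
    vs : List (Vec (Fin m) n)
    vs = allVecs m n
    F : Vec (Fin m) (suc n) → ℕ
    F x = 𝟙 (U x ∧ P (c + wt x))
    row : ∀ i → l * ∑ vs (λ xs → F (i ∷ xs)) ≡ ∑ vs (λ xs → 𝟙 (U (i ∷ xs)))
    row i = trans
      (cong (l *_) (∑-cong vs (λ xs → cong (λ k → 𝟙 (U (i ∷ xs) ∧ P k)) (sym (+-assoc c (toℕ i) (wt xs))))))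
      (balanced-count n (U ∘ (i ∷_)) r (indep ∘ (i ∷_)) (c + toℕ i))

mainTheorem3 : (m n W l : ℕ) → .{{_ : NonZero m}} → .{{_ : NonZero n}} → .{{_ : NonZero W}} → .{{_ : NonZero l}}
    → W ∣ m → l ∣ W → (r : Fin n) → (U : Subset m n) → IndepOf U r
    → l * card (lowPart U W l) ≡ card U
mainTheorem3 m n W l W∣m l∣W r U indep = begin
  l * card (lowPart U W l)                 ≡⟨ cong (l *_) (length-filterᵇ (lowPart U W l) (allVecs m n)) ⟩
  l * ∑ (allVecs m n) (𝟙 ∘ lowPart U W l)
    ≡⟨ balanced-count {l = l} {P = lowResidue W l} (lowResidue-balanced W∣m l∣W) n U r indep 0 ⟩
  ∑ (allVecs m n) (𝟙 ∘ U)                  ≡⟨ length-filterᵇ U (allVecs m n) ⟨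
  card U                                   ∎
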